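{- For every $n\geq1$, the binary expansion of $x_n^{(3)}$ does not begin with the digits $10$ (i.e. its two leading binary digits are $11$).
   Context: For a positive integer $m$, let $\nu_2(m)$ be the exponent of the highest power of $2$ dividing $m$. Define $x_1^{(3)}=3$ and, for $n\ge2$, $x_n^{(3)}$ is the smallest integer $y>x_{n-1}^{(3)}$ with $\nu_2(y)=\nu_2(n)$. -}

module Defs where

open import Data.Nat using (ℕ; zero; suc; _+_; _*_; _^_; _≤_; _<_; _≡ᵇ_)
open import Data.Nat.DivMod using (_/_; _%_)
open import Data.Bool using (if_then_else_)
open import Data.Product using (∃; _×_)

-- 2-adic valuation with fuel (fuel = m suffices for m ≥ 1).
-- Convention ν₂ 0 = 0 (never used: all arguments are positive).
ν₂-go : ℕ → ℕ → ℕ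
ν₂-go zero     m = zero
ν₂-go (suc f)  zero = zero
ν₂-go (suc f)  m@(suc _) =
  if (m % 2) ≡ᵇ 0 then suc (ν₂-go f (m / 2)) else zero

ν₂ : ℕ → ℕ
ν₂ m = ν₂-go m m

search : ℕ → ℕ → ℕ → ℕ
search k zero    y = y
search k (suc f) y = if ν₂ y ≡ᵇ k then y else search k f (suc y)

-- smallest y > p with ν₂ y = k; among any 2^(k+1) consecutive integers
-- there is one (an odd multiple of 2^k), so the fuel suffices.
next : ℕ → ℕ → ℕ
next p k = search k (2 ^ suc k) (suc p)

-- x n = x_n^{(3)} for n ≥ 1 ; x 0 is unused (set to 0 = placeholder)
x : ℕ → ℕ
x zero          = 0
x (suc zero)    = 3
x (suc (suc n)) = next (x (suc n)) (ν₂ (suc (suc n)))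

LeadingBits11 : ℕ → Set
LeadingBits11 m = ∃ λ k → (3 * 2 ^ k ≤ m) × (m < 4 * 2 ^ k)

{-# OPTIONS --safe #-}
module Submission where

-- By induction, x n = n + 2^(k+1) whenever 2^k ≤ n < 2^(k+1), which has leading bits 11.
-- Inside a dyadic block, ν₂ (n + 1 + 2^(k+1)) = ν₂ (n + 1) because ν₂ (n + 1) ≤ k, so
-- x (n + 1) = x n + 1.  At the end of a block (n + 1 = 2^(k+1)) one has x n + 1 = 2^(k+2),
-- and the first y ≥ 2^(k+2) with ν₂ y = k + 1 is 2^(k+2) + 2^(k+1) = (n + 1) + 2^(k+2),
-- since every 2^(k+2) + i with 0 < i < 2^(k+1) has ν₂ = ν₂ i ≤ k.

open import Defs
open import Data.Bool using (if_then_else_)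
open import Data.Nat
open import Data.Nat.Properties
open import Data.Nat.DivMod using (m*n%n≡0; m*n/n≡m; [m+kn]%n≡m%n)
open import Data.Nat.Induction using (<-rec)
open import Data.Nat.Tactic.RingSolver using (solve-∀)
open import Data.Product using (∃; ∃₂; _×_; _,_)
open import Data.Sum using (inj₁; inj₂)
open import Relation.Nullary.Decidable using (dec-true; dec-false)
open import Function using (_∘_)
open import Relation.Binary.PropositionalEquality

2^n<2^[1+n] : ∀ n → 2 ^ n < 2 ^ suc n
2^n<2^[1+n] n = ^-monoʳ-< 2 (s≤s (s≤s z≤n)) (n<1+n n)

n<2^n : ∀ n → n < 2 ^ n
n<2^n zero    = z<s
n<2^n (suc n) = ≤-<-trans (n<2^n n) (2^n<2^[1+n] n)

2^a*odd>0 : ∀ a q → 0 < 2 ^ a * suc (2 * q)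
2^a*odd>0 a q = ≤-trans (m^n>0 2 a) (m≤m*n (2 ^ a) (suc (2 * q)))

2^a*odd<2^b⇒a<b : ∀ {a q b} → 2 ^ a * suc (2 * q) < 2 ^ b → a < b
2^a*odd<2^b⇒a<b {a} {q} lt = ≰⇒> λ b≤a →
  <⇒≱ lt (≤-trans (^-monoʳ-≤ 2 b≤a) (m≤m*n (2 ^ a) (suc (2 * q))))

suc[2q]%2≡1 : ∀ q → suc (2 * q) % 2 ≡ 1
suc[2q]%2≡1 q = trans (cong (λ m → suc m % 2) (*-comm 2 q)) ([m+kn]%n≡m%n 1 q 2)

if-≡ᵇ0-then : ∀ {A : Set} {r} {t e : A} → r ≡ 0 → (if r ≡ᵇ 0 then t else e) ≡ t
if-≡ᵇ0-then refl = refl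

if-≡ᵇ0-else : ∀ {A : Set} {r s} {t e : A} → r ≡ suc s → (if r ≡ᵇ 0 then t else e) ≡ e
if-≡ᵇ0-else refl = refl

ν₂-go-odd : ∀ f q → ν₂-go (suc f) (suc (2 * q)) ≡ 0
ν₂-go-odd f q = if-≡ᵇ0-else (suc[2q]%2≡1 q)

ν₂-go-double : ∀ f m → 0 < m → ν₂-go (suc f) (2 * m) ≡ suc (ν₂-go f m)
ν₂-go-double f m@(suc _) _ = begin
  ν₂-go (suc f) (2 * m)      ≡⟨ cong (ν₂-go (suc f)) (*-comm 2 m) ⟩
  ν₂-go (suc f) (m * 2)      ≡⟨ if-≡ᵇ0-then (m*n%n≡0 m 2) ⟩
  suc (ν₂-go f (m * 2 / 2))  ≡⟨ cong (suc ∘ ν₂-go f) (m*n/n≡m m 2) ⟩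
  suc (ν₂-go f m)            ∎
  where open ≡-Reasoning

ν₂-go-2^a*odd : ∀ f a q → a < f → ν₂-go f (2 ^ a * suc (2 * q)) ≡ a
ν₂-go-2^a*odd (suc f) zero q _ =
  trans (cong (ν₂-go (suc f)) (*-identityˡ (suc (2 * q)))) (ν₂-go-odd f q)
ν₂-go-2^a*odd (suc f) (suc a) q (s≤s a<f) = begin
  ν₂-go (suc f) (2 * 2 ^ a * suc (2 * q))    ≡⟨ cong (ν₂-go (suc f)) (*-assoc 2 (2 ^ a) _) ⟩
  ν₂-go (suc f) (2 * (2 ^ a * suc (2 * q)))  ≡⟨ ν₂-go-double f _ (2^a*odd>0 a q) ⟩
  suc (ν₂-go f (2 ^ a * suc (2 * q)))        ≡⟨ cong suc (ν₂-go-2^a*odd f a q a<f) ⟩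
  suc a                                      ∎
  where open ≡-Reasoning

ν₂-2^a*odd : ∀ a q → ν₂ (2 ^ a * suc (2 * q)) ≡ a
ν₂-2^a*odd a q = ν₂-go-2^a*odd _ a q (<-≤-trans (n<2^n a) (m≤m*n (2 ^ a) (suc (2 * q))))

ν₂-2^ : ∀ b → ν₂ (2 ^ b) ≡ b
ν₂-2^ b = subst (λ m → ν₂ m ≡ b) (*-identityʳ (2 ^ b)) (ν₂-2^a*odd b 0)

data ParityView : ℕ → Set where
  even : ∀ t → ParityView (2 * t)
  odd  : ∀ t → ParityView (suc (2 * t))

parityView : ∀ m → ParityView m
parityView zero = even 0
parityView (suc m) with parityView m
... | even t = odd t
... | odd t  = subst ParityView (*-suc 2 t) (even (suc t))

2^a*odd-decomposition : ∀ m → 0 < m → ∃₂ λ a q → m ≡ 2 ^ a * suc (2 * q)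
2^a*odd-decomposition = <-rec _ decompose
  where
  decompose : ∀ m → (∀ {k} → k < m → 0 < k → ∃₂ λ a q → k ≡ 2 ^ a * suc (2 * q))
            → 0 < m → ∃₂ λ a q → m ≡ 2 ^ a * suc (2 * q)
  -- the clause for even 0 is omitted: it would force m>0 : 0 < 0
  decompose m rec m>0 with parityView m
  ... | odd q = 0 , q , sym (*-identityˡ _)
  ... | even t@(suc _) with rec (<-≤-trans (m<m*n t 2 (s≤s (s≤s z≤n))) (≤-reflexive (*-comm t 2))) z<s
  ...   | a , q , t≡ = suc a , q , trans (cong (2 *_) t≡) (sym (*-assoc 2 (2 ^ a) _))

ν₂<b : ∀ {i b} → 0 < i → i < 2 ^ b → ν₂ i < b
ν₂<b {i} i>0 i<2^b with 2^a*odd-decomposition i i>0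
... | a , q , refl rewrite ν₂-2^a*odd a q = 2^a*odd<2^b⇒a<b {a} {q} i<2^b

ν₂-+-2^ : ∀ {i b} → 0 < i → i < 2 ^ b → ν₂ (i + 2 ^ b) ≡ ν₂ i
ν₂-+-2^ {i} {b} i>0 i<2^b with 2^a*odd-decomposition i i>0
... | a , q , refl with m≤n⇒∃[o]m+o≡n (2^a*odd<2^b⇒a<b {a} {q} {b} i<2^b)
...   | d , refl = begin
  ν₂ (2 ^ a * suc (2 * q) + 2 ^ (suc a + d))     ≡⟨ cong (λ m → ν₂ (2 ^ a * suc (2 * q) + 2 * m)) (^-distribˡ-+-* 2 a d) ⟩
  ν₂ (2 ^ a * suc (2 * q) + 2 * (2 ^ a * 2 ^ d)) ≡⟨ cong ν₂ (factor (2 ^ a) q (2 ^ d)) ⟩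
  ν₂ (2 ^ a * suc (2 * (q + 2 ^ d)))             ≡⟨ ν₂-2^a*odd a (q + 2 ^ d) ⟩
  a                                              ≡⟨ ν₂-2^a*odd a q ⟨
  ν₂ (2 ^ a * suc (2 * q))                       ∎
  where
  open ≡-Reasoning
  factor : ∀ P q D → P * suc (2 * q) + 2 * (P * D) ≡ P * suc (2 * (q + D))
  factor = solve-∀

search-hit : ∀ {K} f y → ν₂ y ≡ K → search K (suc f) y ≡ y
search-hit {K} f y hit = cong (if_then y else search K f (suc y)) (dec-true (ν₂ y ≟ K) hit)

search-miss : ∀ {K} f y → ν₂ y ≢ K → search K (suc f) y ≡ search K f (suc y)
search-miss {K} f y miss = cong (if_then y else search K f (suc y)) (dec-false (ν₂ y ≟ K) miss)

search-finds : ∀ {K} f y M → M < f → (∀ i → i < M → ν₂ (y + i) ≢ K) → ν₂ (y + M) ≡ K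
             → search K f y ≡ y + M
search-finds (suc f) y zero _ _ hit =
  trans (search-hit f y (subst (λ m → ν₂ m ≡ _) (+-identityʳ y) hit)) (sym (+-identityʳ y))
search-finds {K} (suc f) y (suc M) (s≤s M<f) misses hit = begin
  search K (suc f) y  ≡⟨ search-miss f y (subst (λ m → ν₂ m ≢ K) (+-identityʳ y) (misses 0 z<s)) ⟩
  search K f (suc y)  ≡⟨ search-finds f (suc y) M M<f misses′ (subst (λ m → ν₂ m ≡ K) (+-suc y M) hit) ⟩
  suc y + M           ≡⟨ +-suc y M ⟨
  y + suc M           ∎
  where
  open ≡-Reasoning
  misses′ : ∀ i → i < M → ν₂ (suc y + i) ≢ K
  misses′ i i<M = subst (λ m → ν₂ m ≢ K) (+-suc y i) (misses (suc i) (s<s i<M))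

next-inside : ∀ {m b} → suc m < 2 ^ b → next (m + 2 ^ b) (ν₂ (suc m)) ≡ suc m + 2 ^ b
next-inside {m} {b} lt =
  trans (search-finds _ (suc m + 2 ^ b) 0 (m^n>0 2 (suc (ν₂ (suc m)))) (λ _ ()) hit)
        (+-identityʳ (suc m + 2 ^ b))
  where
  hit : ν₂ (suc m + 2 ^ b + 0) ≡ ν₂ (suc m)
  hit = trans (cong ν₂ (+-identityʳ (suc m + 2 ^ b))) (ν₂-+-2^ {b = b} z<s lt)

next-from-2^ : ∀ {p} b → suc p ≡ 2 ^ suc b → next p b ≡ suc p + 2 ^ b
next-from-2^ b p+1≡2^[1+b] =
  subst (λ y → search b (2 ^ suc b) y ≡ y + 2 ^ b) (sym p+1≡2^[1+b])
        (search-finds _ (2 ^ suc b) (2 ^ b) (2^n<2^[1+n] b) misses hit)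
  where
  misses : ∀ i → i < 2 ^ b → ν₂ (2 ^ suc b + i) ≢ b
  misses zero _ eq =
    1+n≢n (trans (sym (trans (cong ν₂ (+-identityʳ (2 ^ suc b))) (ν₂-2^ (suc b)))) eq)
  misses (suc i) i<2^b eq = <⇒≢ (ν₂<b {b = b} z<s i<2^b) (begin
    ν₂ (suc i)               ≡⟨ ν₂-+-2^ {b = suc b} z<s (<-trans i<2^b (2^n<2^[1+n] b)) ⟨
    ν₂ (suc i + 2 ^ suc b)   ≡⟨ cong ν₂ (+-comm (suc i) _) ⟩
    ν₂ (2 ^ suc b + suc i)   ≡⟨ eq ⟩
    b                        ∎)
    where open ≡-Reasoning
  three-times : ∀ P → 2 * P + P ≡ P * suc (2 * 1)
  three-times = solve-∀
  hit : ν₂ (2 ^ suc b + 2 ^ b) ≡ b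
  hit = trans (cong ν₂ (three-times (2 ^ b))) (ν₂-2^a*odd b 1)

ClosedForm : ℕ → Set
ClosedForm n = ∃ λ k → 2 ^ k ≤ n × n < 2 ^ suc k × x n ≡ n + 2 ^ suc k

x-closed-form : ∀ n → ClosedForm (suc n)
x-closed-form zero = 0 , ≤-refl , s<s z<s , refl
x-closed-form (suc n) with x-closed-form n
... | k , lo , hi , xn with m≤n⇒m<n∨m≡n hi
...   | inj₁ inside =
  k , m≤n⇒m≤1+n lo , inside ,
  trans (cong (λ p → next p (ν₂ (suc (suc n)))) xn) (next-inside {b = suc k} inside)
...   | inj₂ boundary =
  suc k , ≤-reflexive (sym boundary) ,
  subst (_< 2 ^ suc (suc k)) (sym boundary) (2^n<2^[1+n] (suc k)) , (begin
    next (x (suc n)) (ν₂ (suc (suc n)))     ≡⟨ cong₂ next xn (trans (cong ν₂ boundary) (ν₂-2^ (suc k))) ⟩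
    next (suc n + P) (suc k)                ≡⟨ next-from-2^ (suc k) (trans (cong (_+ P) boundary) (double P)) ⟩
    suc (suc n) + P + P                     ≡⟨ +-assoc (suc (suc n)) P P ⟩
    suc (suc n) + (P + P)                   ≡⟨ cong (suc (suc n) +_) (double P) ⟩
    suc (suc n) + 2 ^ suc (suc k)           ∎)
  where
  open ≡-Reasoning
  P = 2 ^ suc k
  double : ∀ m → m + m ≡ 2 * m
  double = solve-∀

n+2^[1+k]-leading11 : ∀ {n k} → 2 ^ k ≤ n → n < 2 ^ suc k → LeadingBits11 (n + 2 ^ suc k)
n+2^[1+k]-leading11 {n} {k} lo hi =
  k , subst (_≤ n + 2 ^ suc k) (sym (three (2 ^ k))) (+-monoˡ-≤ (2 ^ suc k) lo)
    , subst (n + 2 ^ suc k <_) (sym (four (2 ^ k))) (+-monoˡ-< (2 ^ suc k) hi)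
  where
  three : ∀ P → 3 * P ≡ P + 2 * P
  three = solve-∀
  four : ∀ P → 4 * P ≡ 2 * P + 2 * P
  four = solve-∀

corollary2 : (n : ℕ) → n ≥ 1 → LeadingBits11 (x n)
corollary2 (suc n) _ with x-closed-form n
... | k , lo , hi , xn = subst LeadingBits11 (sym xn) (n+2^[1+k]-leading11 {k = k} lo hi)
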